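{- Let $2\le k<g$ be integers. If there is a positive integer $s\le k-1$ such that $s\,\frac{g-k}{k^2-1}$ is an integer, then $Y(g,k)$ is a complete Young graph.
   Context: For integers $2\le k<g$, the labeled directed graph $H(g,k)$ has a distinguished starting node $[[0,0]]$ and other nodes labeled by pairs $[R,r]$ of integers with $0\le R,r\le k-1$ (the node $[0,0]$ is distinct from the starting node). For a node $[P,p]$ (the starting node treated as $[0,0]$ here) there is an edge labeled $(A,a)$ from $[P,p]$ to $[R,r]$ whenever $0\le A,a\le g-1$ are integers, $0\le R,r\le k-1$, $ka+p=A+rg$ and $kA+R=a+Pg$; edges leaving the starting node additionally require $A\ne0\ne a$; no edge enters the starting node. $H(g,k)$ consists of the starting node and all nodes reachable from it. An even pivot node is a node $[a,a]$; an odd pivot node is a node $[r,s]$ with an edge to $[s,r]$; the starting node is not a pivot node. $Y(g,k)$ is obtained from $H(g,k)$ by deleting every node that is not a pivot node and from which no pivot node is reachable, with incident edges. $Y(g,k)$ is a complete Young graph (on $m$ nodes) if its nodes other than the starting node are $m$ nodes forming the complete directed graph on them (an edge from each to each, including self-loops) and there is an edge from the starting node to every node except $[0,0]$. -}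

module Defs where

open import Data.Nat using (ℕ; _+_; _*_; _∸_; _<_; _≤_)
open import Data.Product using (Σ; ∃; _×_)
open import Relation.Binary.PropositionalEquality using (_≡_; _≢_)
open import Relation.Binary.Construct.Closure.ReflexiveTransitive using (Star)
open import Relation.Nullary using (¬_)

-- Nodes of H(g,k): the distinguished starting node [[0,0]], or a pair [R,r].
data Node : Set where
  start : Node
  nd    : ℕ → ℕ → Node

-- Edge labelled (A,a) from [P,p] to [R,r], the starting node being treated
-- as [0,0], in the raw graph before restricting to reachable nodes.
data Edge (g k : ℕ) : Node → ℕ → ℕ → Node → Set where
  fromNode : ∀ {P p A a R r} →
    A < g → a < g → R < k → r < k →
    k * a + p ≡ A + r * g →
    k * A + R ≡ a + P * g →
    Edge g k (nd P p) A a (nd R r)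
  fromStart : ∀ {A a R r} →
    A < g → a < g → R < k → r < k →
    k * a + 0 ≡ A + r * g →
    k * A + R ≡ a + 0 * g →
    A ≢ 0 → a ≢ 0 →
    Edge g k start A a (nd R r)

Step : (g k : ℕ) → Node → Node → Set
Step g k u v = ∃ λ A → ∃ λ a → Edge g k u A a v

Reach : (g k : ℕ) → Node → Node → Set
Reach g k = Star (Step g k)

InH : (g k : ℕ) → Node → Set
InH g k v = Reach g k start v

data PivotShape (g k : ℕ) : Node → Set where
  even : ∀ {a} → PivotShape g k (nd a a)
  odd  : ∀ {r s} → Step g k (nd r s) (nd s r) → PivotShape g k (nd r s)

Pivot : (g k : ℕ) → Node → Set
Pivot g k v = InH g k v × PivotShape g k v

-- Nodes of Y(g,k): nodes of H that are pivots or from which a pivot is reachable.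
-- (Paths starting at a node of H stay in H, so reachability in H = Reach.)
InY : (g k : ℕ) → Node → Set
InY g k v = InH g k v × ∃ λ w → Pivot g k w × Reach g k v w

CompleteYoung : (g k : ℕ) → Set
CompleteYoung g k =
  InY g k start ×
  (∀ u v → InY g k u → InY g k v → u ≢ start → v ≢ start → Step g k u v) ×
  (∀ v → InY g k v → v ≢ start → v ≢ nd 0 0 → Step g k start v)

module Submission where

-- Write g = k + D (so D ≥ 1) and M = k² − 1.  For an edge (A,a) leaving a
-- diagonal node [P,P] towards [R,r], eliminating A from the two edge equations
-- gives the balance equation  M·a + R = M·r + r + (k·r + P)·D.
--
-- Reduced mod M and multiplied by the given s (for which M ∣ s·D) it says
-- s·R ≡ s·r (mod M); both sides are smaller than M, hence R = r.  Then the
-- balance equation says M ∣ (k·R + P)·D, so M ∣ P·D implies M ∣ k·R·D, and as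
-- k is invertible modulo M (k² = M + 1) also M ∣ R·D.  Hence every node of
-- H(g,k) is a "Young node" [R,R] with R < k and M ∣ R·D (the starting node
-- behaving like [0,0]).  Conversely, between any two Young nodes there is an
-- explicit edge, and from the starting node to every Young node except [0,0];
-- [s,s] is such a node and an even pivot.  Together these give that Y(g,k) is
-- the complete Young graph on the Young nodes.

open import Defs
open import Data.Nat using (ℕ; _*_; _∸_; _<_; _≤_)
open import Data.Nat.Divisibility using (_∣_)
open import Data.Product using (∃; _×_)

open import Data.Nat using (suc; zero; _+_; s≤s; z<s; NonZero; >-nonZero)
open import Data.Nat.Properties
open import Data.Nat.Divisibility
  using (divides; ∣m∣n⇒∣m+n; ∣m+n∣m⇒∣n; m∣m*n; ∣n⇒∣m*n; _∣0)
open import Data.Nat.DivMod using (_%_; m<n⇒m%n≡m; %-remove-+ˡ)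
open import Data.Nat.Tactic.RingSolver using (solve)
open import Data.List using (_∷_; [])
open import Data.Product using (_,_)
open import Data.Sum using (inj₁; inj₂)
open import Data.Unit using (⊤; tt)
open import Relation.Nullary using (contradiction)
open import Relation.Binary.PropositionalEquality
open import Relation.Binary.Construct.Closure.ReflexiveTransitive using (ε; _◅_)

residues-agree : ∀ {d m n u v} → d ∣ m → d ∣ n → m + u ≡ n + v →
  u < d → v < d → u ≡ v
residues-agree {d@(suc _)} {m} {n} {u} {v} d∣m d∣n eq u<d v<d = begin
  u           ≡⟨ m<n⇒m%n≡m u<d ⟨
  u % d       ≡⟨ %-remove-+ˡ u d∣m ⟨
  (m + u) % d ≡⟨ cong (_% d) eq ⟩
  (n + v) % d ≡⟨ %-remove-+ˡ v d∣n ⟩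
  v % d       ≡⟨ m<n⇒m%n≡m v<d ⟩
  v           ∎
  where open ≡-Reasoning

-- If k² = M + 1 then k is invertible modulo M, so M ∣ k·n forces M ∣ n.
∣k*n⇒∣n : ∀ {k M} n → k * k ≡ suc M → M ∣ k * n → M ∣ n
∣k*n⇒∣n {k} {M} n k*k≡1+M M∣kn = ∣m+n∣m⇒∣n M∣Mn+n (m∣m*n n)
  where
  k[kn]≡Mn+n : k * (k * n) ≡ M * n + n
  k[kn]≡Mn+n = begin
    k * (k * n)   ≡⟨ *-assoc k k n ⟨
    k * k * n     ≡⟨ cong (_* n) k*k≡1+M ⟩
    suc M * n     ≡⟨ +-comm n (M * n) ⟩
    M * n + n     ∎
    where open ≡-Reasoning
  M∣Mn+n : M ∣ M * n + n
  M∣Mn+n = subst (M ∣_) k[kn]≡Mn+n (∣n⇒∣m*n k M∣kn)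

two-digits<k² : ∀ {k P R} → P < k → R < k → P + k * R < k * k
two-digits<k² {k} {P} {R} P<k R<k = begin-strict
  P + k * R     <⟨ +-monoˡ-< (k * R) P<k ⟩
  k + k * R     ≡⟨ *-suc k R ⟨
  k * suc R     ≤⟨ *-monoʳ-≤ k R<k ⟩
  k * k         ∎
  where open ≤-Reasoning

product<k²-1 : ∀ {k M s R} → k * k ≡ suc M → 0 < s → s < k → R < k → s * R < M
product<k²-1 {k} {M} {s} {R} k*k≡1+M 0<s s<k R<k = begin-strict
  s * R              <⟨ m<m+n (s * R) 0<s ⟩
  s * R + s          ≤⟨ m≤m+n (s * R + s) R ⟩
  s * R + s + R      ≤⟨ ≤-pred 1+sR+s+R≤1+M ⟩
  M                  ∎
  where
  open ≤-Reasoning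
  1+sR+s+R≤1+M : suc (s * R + s + R) ≤ suc M
  1+sR+s+R≤1+M = begin
    suc (s * R + s + R) ≡⟨ solve (s ∷ R ∷ []) ⟩
    suc s * suc R       ≤⟨ *-mono-≤ s<k R<k ⟩
    k * k               ≡⟨ k*k≡1+M ⟩
    suc M               ∎

start-edge⇒zero-edge : ∀ {g k A a v} → Edge g k start A a v → Edge g k (nd 0 0) A a v
start-edge⇒zero-edge (fromStart A<g a<g R<k r<k e₁ e₂ _ _) = fromNode A<g a<g R<k r<k e₁ e₂

zero-edge⇒start-edge : ∀ {g k A a v} → Edge g k (nd 0 0) A a v →
  A ≢ 0 → a ≢ 0 → Edge g k start A a v
zero-edge⇒start-edge (fromNode A<g a<g R<k r<k e₁ e₂) = fromStart A<g a<g R<k r<k e₁ e₂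

module YoungGraph (k D M : ℕ) .{{_ : NonZero M}} (k*k≡1+M : k * k ≡ suc M) where

  -- Balance equation of an edge (A,a) from [P,P] to [R,r]: k·(first equation)
  -- plus the second one, with k·A + k·P + a cancelled.
  balance : ∀ {P A a R r} →
    k * a + P ≡ A + r * (k + D) → k * A + R ≡ a + P * (k + D) →
    M * a + R ≡ M * r + r + (k * r + P) * D
  balance {P} {A} {a} {R} {r} e₁ e₂ = +-cancelʳ-≡ (a + k * A + k * P) _ _ (begin
    (M * a + R) + (a + k * A + k * P)             ≡⟨ solve (M ∷ a ∷ R ∷ k ∷ A ∷ P ∷ []) ⟩
    suc M * a + k * P + (k * A + R)               ≡⟨ cong (λ t → t * a + k * P + (k * A + R)) k*k≡1+M ⟨
    k * k * a + k * P + (k * A + R)               ≡⟨ solve (k ∷ a ∷ P ∷ A ∷ R ∷ []) ⟩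
    k * (k * a + P) + (k * A + R)                 ≡⟨ cong₂ (λ x y → k * x + y) e₁ e₂ ⟩
    k * (A + r * (k + D)) + (a + P * (k + D))     ≡⟨ solve (k ∷ A ∷ r ∷ D ∷ a ∷ P ∷ []) ⟩
    k * k * r + ((k * r + P) * D + (a + k * A + k * P))
      ≡⟨ cong (λ t → t * r + ((k * r + P) * D + (a + k * A + k * P))) k*k≡1+M ⟩
    suc M * r + ((k * r + P) * D + (a + k * A + k * P))
      ≡⟨ solve (M ∷ r ∷ k ∷ P ∷ D ∷ a ∷ A ∷ []) ⟩
    (M * r + r + (k * r + P) * D) + (a + k * A + k * P) ∎)
    where open ≡-Reasoning

  -- First edge equation for the label (P + x + k·y, R + y + k·x) from [P,P]
  -- to [R,R] when R·D = x·M; the second equation is this one with the roles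
  -- of (P,y) and (R,x) exchanged.
  diagonal-equation : ∀ {P y R x} → R * D ≡ x * M →
    k * (R + (y + k * x)) + P ≡ (P + (x + k * y)) + R * (k + D)
  diagonal-equation {P} {y} {R} {x} R*D≡x*M = begin
    k * (R + (y + k * x)) + P             ≡⟨ solve (k ∷ R ∷ y ∷ x ∷ P ∷ []) ⟩
    k * R + k * y + P + k * k * x         ≡⟨ cong (λ t → k * R + k * y + P + t * x) k*k≡1+M ⟩
    k * R + k * y + P + suc M * x         ≡⟨ solve (k ∷ R ∷ y ∷ P ∷ M ∷ x ∷ []) ⟩
    P + (x + k * y) + (R * k + x * M)     ≡⟨ cong (λ t → P + (x + k * y) + (R * k + t)) R*D≡x*M ⟨
    P + (x + k * y) + (R * k + R * D)     ≡⟨ cong (P + (x + k * y) +_) (*-distribˡ-+ R k D) ⟨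
    P + (x + k * y) + R * (k + D)         ∎
    where open ≡-Reasoning

  -- The labels of these edges are below g = k + D: the quotients satisfy
  -- M·(y + k·x) = (P + k·R)·D ≤ M·D.
  quotient-bound : ∀ {P y R x} → P < k → R < k → P * D ≡ y * M → R * D ≡ x * M →
    y + k * x ≤ D
  quotient-bound {P} {y} {R} {x} P<k R<k P*D≡y*M R*D≡x*M =
    *-cancelʳ-≤ (y + k * x) D M (begin
      (y + k * x) * M       ≡⟨ solve (y ∷ k ∷ x ∷ M ∷ []) ⟩
      y * M + k * (x * M)   ≡⟨ cong₂ (λ u v → u + k * v) P*D≡y*M R*D≡x*M ⟨
      P * D + k * (R * D)   ≡⟨ solve (P ∷ D ∷ k ∷ R ∷ []) ⟩
      (P + k * R) * D       ≤⟨ *-monoˡ-≤ D P+kR≤M ⟩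
      M * D                 ≡⟨ *-comm M D ⟩
      D * M                 ∎)
    where
    open ≤-Reasoning
    P+kR≤M : P + k * R ≤ M
    P+kR≤M = ≤-pred (subst (P + k * R <_) k*k≡1+M (two-digits<k² P<k R<k))

  diagonal-edge : ∀ {P y R x} → P < k → R < k → P * D ≡ y * M → R * D ≡ x * M →
    Edge (k + D) k (nd P P) (P + (x + k * y)) (R + (y + k * x)) (nd R R)
  diagonal-edge {P} {y} {R} {x} P<k R<k P*D≡y*M R*D≡x*M =
    fromNode
      (+-mono-<-≤ P<k (quotient-bound {R} {x} {P} {y} R<k P<k R*D≡x*M P*D≡y*M))
      (+-mono-<-≤ R<k (quotient-bound {P} {y} {R} {x} P<k R<k P*D≡y*M R*D≡x*M))
      R<k R<k
      (diagonal-equation {P} {y} {R} {x} R*D≡x*M)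
      (diagonal-equation {R} {x} {P} {y} P*D≡y*M)

  -- Young nodes: diagonal nodes [R,R] with R < k and M ∣ R·D; the starting
  -- node counts as one (it behaves like [0,0]).
  Young : Node → Set
  Young start    = ⊤
  Young (nd R r) = R ≡ r × R < k × M ∣ R * D

  young-step : ∀ {P R} → P < k → R < k → M ∣ P * D → M ∣ R * D →
    Step (k + D) k (nd P P) (nd R R)
  young-step {P} {R} P<k R<k (divides y P*D≡y*M) (divides x R*D≡x*M) =
    _ , _ , diagonal-edge {P} {y} {R} {x} P<k R<k P*D≡y*M R*D≡x*M

  -- For D ≥ 1 the starting node reaches every Young node [R,R] with R ≠ 0:
  -- the edge from [0,0] has labels x and R + k·x, where R·D = x·M, x ≠ 0.
  start-step : ∀ {R} → 0 < D → 0 < R → R < k → M ∣ R * D → Step (k + D) k start (nd R R)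
  start-step {R} 0<D 0<R R<k (divides x R*D≡x*M) =
    _ , _ , zero-edge⇒start-edge [0,0]→[R,R] x≢0 (λ eq → <⇒≢ 0<R (sym (m+n≡0⇒m≡0 R eq)))
    where
    [0,0]→[R,R] : Edge (k + D) k (nd 0 0) (0 + (x + k * 0)) (R + (0 + k * x)) (nd R R)
    [0,0]→[R,R] = diagonal-edge {0} {0} {R} {x} (≤-trans z<s R<k) R<k refl R*D≡x*M
    x≢0 : x + k * 0 ≢ 0
    x≢0 eq with m*n≡0⇒m≡0∨n≡0 R (trans R*D≡x*M (cong (_* M) (m+n≡0⇒m≡0 x eq)))
    ... | inj₁ R≡0 = <⇒≢ 0<R (sym R≡0)
    ... | inj₂ D≡0 = <⇒≢ 0<D (sym D≡0)

  module Closure (s : ℕ) (0<s : 0 < s) (s<k : s < k) (M∣sD : M ∣ s * D) where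

    -- An edge leaving any diagonal node [P,P] ends at a diagonal node: s·R and s·r
    -- agree modulo M by the balance equation, and are both below M.
    lands-on-diagonal : ∀ {P A a R r} → R < k → r < k →
      k * a + P ≡ A + r * (k + D) → k * A + R ≡ a + P * (k + D) → R ≡ r
    lands-on-diagonal {P} {A} {a} {R} {r} R<k r<k e₁ e₂ =
      *-cancelˡ-≡ R r s {{>-nonZero 0<s}}
        (residues-agree (∣n⇒∣m*n s (m∣m*n a))
                        (∣m∣n⇒∣m+n (m∣m*n (s * r)) (∣n⇒∣m*n (k * r + P) M∣sD))
                        scaled-balance
                        (product<k²-1 k*k≡1+M 0<s s<k R<k)
                        (product<k²-1 k*k≡1+M 0<s s<k r<k))
      where
      open ≡-Reasoning
      scaled-balance : s * (M * a) + s * R ≡ (M * (s * r) + (k * r + P) * (s * D)) + s * r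
      scaled-balance = begin
        s * (M * a) + s * R                     ≡⟨ *-distribˡ-+ s (M * a) R ⟨
        s * (M * a + R)                         ≡⟨ cong (s *_) (balance e₁ e₂) ⟩
        s * (M * r + r + (k * r + P) * D)       ≡⟨ solve (s ∷ M ∷ r ∷ k ∷ P ∷ D ∷ []) ⟩
        M * (s * r) + (k * r + P) * (s * D) + s * r ∎

    -- Divisibility propagates along edges between diagonal nodes: by the
    -- balance equation M ∣ P·D + k·(R·D), hence M ∣ k·(R·D) and M ∣ R·D.
    divisibility-propagates : ∀ {P A a R} → M ∣ P * D →
      k * a + P ≡ A + R * (k + D) → k * A + R ≡ a + P * (k + D) → M ∣ R * D
    divisibility-propagates {P} {A} {a} {R} M∣PD e₁ e₂ =
      ∣k*n⇒∣n {k} (R * D) k*k≡1+M (∣m+n∣m⇒∣n M∣PD+kRD M∣PD)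
      where
      open ≡-Reasoning
      Ma≡MR+[PD+kRD] : M * a ≡ M * R + (P * D + k * (R * D))
      Ma≡MR+[PD+kRD] = +-cancelʳ-≡ R _ _ (begin
        M * a + R                                ≡⟨ balance e₁ e₂ ⟩
        M * R + R + (k * R + P) * D              ≡⟨ solve (M ∷ R ∷ k ∷ P ∷ D ∷ []) ⟩
        M * R + (P * D + k * (R * D)) + R        ∎)
      M∣PD+kRD : M ∣ P * D + k * (R * D)
      M∣PD+kRD = ∣m+n∣m⇒∣n (subst (M ∣_) Ma≡MR+[PD+kRD] (m∣m*n a)) (m∣m*n R)

    diagonal-edge-young : ∀ {P A a v} → M ∣ P * D → Edge (k + D) k (nd P P) A a v → Young v
    diagonal-edge-young M∣PD (fromNode _ _ R<k r<k e₁ e₂)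
      with lands-on-diagonal R<k r<k e₁ e₂
    ... | refl = refl , R<k , divisibility-propagates M∣PD e₁ e₂

    step-young : ∀ {u v} → Young u → Step (k + D) k u v → Young v
    step-young {start}  _                 (_ , _ , e) =
      diagonal-edge-young (M ∣0) (start-edge⇒zero-edge e)
    step-young {nd P P} (refl , _ , M∣PD) (_ , _ , e) = diagonal-edge-young M∣PD e

    reach-young : ∀ {u v} → Young u → Reach (k + D) k u v → Young v
    reach-young yu ε          = yu
    reach-young yu (st ◅ sts) = reach-young (step-young yu st) sts

    in-H⇒young : ∀ {v} → InH (k + D) k v → Young v
    in-H⇒young = reach-young tt

    -- Y(k + D, k) is complete: the starting node survives because [s,s] is an
    -- even pivot reached by one edge, and Young nodes are pairwise joined.
    complete : 0 < D → CompleteYoung (k + D) k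
    complete 0<D = start-in-Y , young-to-young , start-to-young
      where
      start→[s,s] : Step (k + D) k start (nd s s)
      start→[s,s] = start-step 0<D 0<s s<k M∣sD

      start-in-Y : InY (k + D) k start
      start-in-Y = ε , nd s s , (start→[s,s] ◅ ε , even) , start→[s,s] ◅ ε

      young-to-young : ∀ u v → InY (k + D) k u → InY (k + D) k v →
        u ≢ start → v ≢ start → Step (k + D) k u v
      young-to-young u v (Hu , _) (Hv , _) u≢start v≢start
        with u | v | in-H⇒young Hu | in-H⇒young Hv
      ... | start  | _      | _                 | _ = contradiction refl u≢start
      ... | nd _ _ | start  | _                 | _ = contradiction refl v≢start
      ... | nd _ _ | nd _ _ | refl , P<k , M∣PD | refl , R<k , M∣RD =
        young-step P<k R<k M∣PD M∣RD

      start-to-young : ∀ v → InY (k + D) k v → v ≢ start → v ≢ nd 0 0 →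
        Step (k + D) k start v
      start-to-young v (Hv , _) v≢start v≢[0,0] with v | in-H⇒young Hv
      ... | start        | _ = contradiction refl v≢start
      ... | nd zero _    | refl , _ = contradiction refl v≢[0,0]
      ... | nd (suc R) _ | refl , R<k , M∣RD = start-step 0<D z<s R<k M∣RD

lemma6 : (g k : ℕ) → 2 ≤ k → k < g →
    (∃ λ s → 1 ≤ s × s ≤ k ∸ 1 × (k * k ∸ 1) ∣ s * (g ∸ k)) →
    CompleteYoung g k
lemma6 g k@(suc (suc _)) (s≤s (s≤s _)) k<g (s , 1≤s , s≤k-1 , M∣sD) =
  subst (λ h → CompleteYoung h k) (m+[n∸m]≡n (<⇒≤ k<g))
    (Closure.complete (k * k ∸ 1) refl s 1≤s (s≤s s≤k-1) M∣sD (m<n⇒0<n∸m k<g))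
  where open YoungGraph k (g ∸ k)
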